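{- Let $\mathbb{A}$ be a nonnegative tensor of order $m\ge2$ and dimension $n$. For each $j\in[n]$ let $x_j^{(0)}=e_j$ and $x_j^{(k+1)}=\mathbb{A}x_j^{(k)}$ for $k\ge0$. Then $\mathbb{A}$ is primitive if and only if there exists a positive integer $k$ such that $x_j^{(k)}>0$ (entrywise) for all $j\in[n]$. Furthermore, the smallest such $k$ is the primitive degree $\gamma(\mathbb{A})$, and $\gamma(\mathbb{A})\le (n-1)^2+1$.
   Context: A tensor of order $m$ and dimension $n$ is an array $\mathbb{A}=(a_{i_1\cdots i_m})$ with indices in $[n]=\{1,\dots,n\}$; nonnegative means all entries are nonnegative reals. $e_j$ is the $j$-th standard basis vector of $\mathbb{R}^n$; for $x\in\mathbb{R}^n$, $(\mathbb{A}x)_i=\sum_{i_2,\dots,i_m=1}^n a_{ii_2\cdots i_m}x_{i_2}\cdots x_{i_m}$, and $x^{[r]}=(x_1^r,\dots,x_n^r)^T$. Define $T_{\mathbb{A}}(x)=(\mathbb{A}x)^{[1/(m-1)]}$. $\mathbb{A}$ is primitive if there is a positive integer $r$ such that $T_{\mathbb{A}}^r(x)>0$ for all nonnegative nonzero $x\in\mathbb{R}^n$; the smallest such $r$ is the primitive degree $\gamma(\mathbb{A})$. -}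

module Defs where

open import Level using (Level; _⊔_) renaming (suc to lsuc)
open import Data.Nat as ℕ using (ℕ; zero; suc; _∸_)
open import Data.Fin using (Fin; zero; suc)
open import Data.Fin.Properties using (_≟_)
open import Data.Product using (Σ; ∃; _×_; _,_)
open import Relation.Nullary using (¬_; yes; no)
open import Relation.Binary.Structures using (IsTotalOrder)
open import Algebra.Bundles using (CommutativeRing)
open import Function using (_⇔_)

pow : ∀ {c ℓ} (R : CommutativeRing c ℓ) → CommutativeRing.Carrier R → ℕ → CommutativeRing.Carrier R
pow R x zero    = CommutativeRing.1# R
pow R x (suc k) = CommutativeRing._*_ R x (pow R x k)

-- A model of the real numbers: a Dedekind-complete ordered field
-- (unique up to isomorphism, so this pins down ℝ), equipped with the
-- nonnegative k-th root function (determined uniquely on x ≥ 0).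
record Reals (c ℓ₁ ℓ₂ : Level) : Set (lsuc (c ⊔ ℓ₁ ⊔ ℓ₂)) where
  field
    field-ℝ : CommutativeRing c ℓ₁
  open CommutativeRing field-ℝ public
  field
    _≤_          : Carrier → Carrier → Set ℓ₂
    isTotalOrder : IsTotalOrder _≈_ _≤_
    nontrivial   : ¬ (1# ≈ 0#)
    inverse      : ∀ x → ¬ (x ≈ 0#) → ∃ λ y → x * y ≈ 1#
    +-mono-≤     : ∀ {x y} z → x ≤ y → (x + z) ≤ (y + z)
    *-nonneg     : ∀ {x y} → 0# ≤ x → 0# ≤ y → 0# ≤ (x * y)
    complete     : (P : Carrier → Set (c ⊔ ℓ₁ ⊔ ℓ₂)) → (∃ P) →
                   (∃ λ b → ∀ x → P x → x ≤ b) →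
                   ∃ λ s → (∀ x → P x → x ≤ s) × (∀ b → (∀ x → P x → x ≤ b) → s ≤ b)
  field
    root         : ℕ → Carrier → Carrier
    root-nonneg  : ∀ k {x} → 0# ≤ x → 0# ≤ root (suc k) x
    root-pow     : ∀ k {x} → 0# ≤ x → pow field-ℝ (root (suc k) x) (suc k) ≈ x

  _<_ : Carrier → Carrier → Set (ℓ₁ ⊔ ℓ₂)
  x < y = (x ≤ y) × ¬ (x ≈ y)

module Tensors {c ℓ₁ ℓ₂ : Level} (ℝ : Reals c ℓ₁ ℓ₂) where
  open Reals ℝ using (Carrier; _≈_; _+_; _*_; 0#; 1#; _≤_; _<_; root)

  sumFin : (n : ℕ) → (Fin n → Carrier) → Carrier
  sumFin zero    f = 0#
  sumFin (suc n) f = f zero + sumFin n (λ i → f (suc i))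

  prodFin : (n : ℕ) → (Fin n → Carrier) → Carrier
  prodFin zero    f = 1#
  prodFin (suc n) f = f zero * prodFin n (λ i → f (suc i))

  sumTuples : (k n : ℕ) → ((Fin k → Fin n) → Carrier) → Carrier
  sumTuples zero    n f = f (λ ())
  sumTuples (suc k) n f =
    sumFin n (λ i → sumTuples k n (λ t → f (λ { zero → i ; (suc j) → t j })))

  Vector : ℕ → Set c
  Vector n = Fin n → Carrier

  -- tensor of order m and dimension n: a i (i₂,…,i_m) = a_{i i₂ ⋯ i_m}
  record Tensor (m n : ℕ) : Set c where
    constructor tensor
    field
      entry : Fin n → (Fin (m ∸ 1) → Fin n) → Carrier
  open Tensor public

  NonnegTensor : ∀ {m n} → Tensor m n → Set ℓ₂
  NonnegTensor A = ∀ i t → 0# ≤ entry A i t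

  apply : ∀ {m n} → Tensor m n → Vector n → Vector n
  apply {m} {n} A x i =
    sumTuples (m ∸ 1) n (λ t → entry A i t * prodFin (m ∸ 1) (λ j → x (t j)))

  T : ∀ {m n} → Tensor m n → Vector n → Vector n
  T {m} A x i = root (m ∸ 1) (apply A x i)

  iter : ∀ {n} → (Vector n → Vector n) → ℕ → Vector n → Vector n
  iter f zero    x = x
  iter f (suc r) x = f (iter f r x)

  e : ∀ {n} → Fin n → Vector n
  e j i with j ≟ i
  ... | yes _ = 1#
  ... | no  _ = 0#

  Nonneg : ∀ {n} → Vector n → Set ℓ₂
  Nonneg x = ∀ i → 0# ≤ x i

  Nonzero : ∀ {n} → Vector n → Set ℓ₁
  Nonzero x = ∃ λ i → ¬ (x i ≈ 0#)

  Positive : ∀ {n} → Vector n → Set (ℓ₁ ⊔ ℓ₂)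
  Positive x = ∀ i → 0# < x i

  PrimitiveAt : ∀ {m n} → Tensor m n → ℕ → Set (c ⊔ ℓ₁ ⊔ ℓ₂)
  PrimitiveAt A r = ∀ x → Nonneg x → Nonzero x → Positive (iter (T A) r x)

  Primitive : ∀ {m n} → Tensor m n → Set (c ⊔ ℓ₁ ⊔ ℓ₂)
  Primitive A = ∃ λ r → 1 ℕ.≤ r × PrimitiveAt A r

  IsLeastPos : ∀ {a} → (ℕ → Set a) → ℕ → Set a
  IsLeastPos P r = (1 ℕ.≤ r × P r) × (∀ s → 1 ℕ.≤ s → P s → r ℕ.≤ s)

  IsPrimitiveDegree : ∀ {m n} → Tensor m n → ℕ → Set (c ⊔ ℓ₁ ⊔ ℓ₂)
  IsPrimitiveDegree A γ = IsLeastPos (PrimitiveAt A) γ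

  xs : ∀ {m n} → Tensor m n → Fin n → ℕ → Vector n
  xs A j k = iter (apply A) k (e j)

  AllPositiveAt : ∀ {m n} → Tensor m n → ℕ → Set (ℓ₁ ⊔ ℓ₂)
  AllPositiveAt A k = ∀ j → Positive (xs A j k)

module Submission where

-- Whether (A x)_i vanishes depends only on where the nonnegative
-- vector x vanishes, so A and T_A = (A ·)^[1/(m-1)] act on zero patterns by the
-- same monotone map F on subsets of [n]: F b is the support of A χ_b.  Hence
-- "T_A^r x > 0 for every x ≥ 0, x ≠ 0" and "x_j^(r) = A^r e_j > 0 for every j"
-- both say that F^r ⁅j⁆ = [n] for every j, which gives the equivalence and the
-- description of γ(A).  The bound γ(A) ≤ (n-1)²+1 is Wielandt's argument for
-- the digraph u → w ⇔ w ∈ F ⁅u⁆: from every j a short cycle is reachable, and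
-- iterating along it fills [n] after at most (n-1)²+1 steps.
-- Equality of reals is undecidable, so F exists only under double negation;
-- every conclusion that uses it is negative or decidable, hence unaffected.

open import Defs
open import Level using (Level; _⊔_)
open import Data.Nat as ℕ using (ℕ; zero; suc)
open import Data.Fin as Fin using (Fin)
open import Data.Fin.Subset using (Subset; _∈_; _∉_; _⊆_; _⊂_; ⁅_⁆; ∣_∣)
open import Data.Fin.Subset.Properties using (_∈?_; x∈⁅x⁆; x∈⁅y⁆⇒x≡y)
open import Data.Product using (∃; ∃₂; _×_; _,_; proj₁; proj₂)
open import Data.Sum using (_⊎_; inj₁; inj₂)
open import Relation.Nullary using (¬_; Dec; yes; no; does)
open import Relation.Nullary.Negation using (contradiction)
open import Relation.Binary.PropositionalEquality
  using (_≡_; _≢_; refl; sym; trans; cong; cong-app; subst; subst₂; module ≡-Reasoning)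

module Combinatorics where

  open import Data.Nat using (_≤_; _<_; _+_; _*_; _∸_; _^_; z≤n; s≤s; _<?_)
  open import Data.Nat.Properties as ℕₚ
    using (≤-refl; ≤-trans; ≤-antisym; ≤-reflexive; +-comm; +-suc; +-identityʳ; m≤m+n; m≤m*n; m∸n+n≡m;
           m≤n⇒∃[o]m+o≡n; ≮⇒≥)
  open import Data.Nat.Tactic.RingSolver using (solve-∀)
  open import Data.Fin using (toℕ; punchOut)
  open import Data.Fin.Properties using (_≟_; any?; pigeonhole; toℕ<n; punchOut-injective)
  open import Data.Fin.Subset.Properties using (_⊂?_; ∣⁅x⁆∣≡1; ⊆-antisym; p⊂q⇒∣p∣<∣q∣; ∣p∣≤n; ∣p∣≡n⇒p≡⊤; ∈⊤)
  open import Data.Vec using (tabulate; []; _∷_)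
  open import Data.Bool using (true; false)
  open import Data.Vec.Properties using (lookup∘tabulate; []=⇒lookup; lookup⇒[]=)
  open import Relation.Nullary.Decidable using (_×-dec_; ¬?; dec-true)
  import Function.Endo.Propositional as Endo

  _^[_] : ∀ {a} {A : Set a} → (A → A) → ℕ → A → A
  f ^[ r ] = Endo._^_ _ f r

  Full : ∀ {n} → Subset n → Set
  Full p = ∀ i → i ∈ p

  subset : ∀ {n p} {P : Fin n → Set p} → (∀ i → Dec (P i)) → Subset n
  subset P? = tabulate (λ i → does (P? i))

  subset-∈ : ∀ {n p} {P : Fin n → Set p} (P? : ∀ i → Dec (P i)) {i} → i ∈ subset P? → P i
  subset-∈ P? {i} i∈ with P? i | trans (sym (lookup∘tabulate (λ i → does (P? i)) i)) ([]=⇒lookup i∈)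
  ... | yes p | _  = p
  ... | no _  | ()

  ∈-subset : ∀ {n p} {P : Fin n → Set p} (P? : ∀ i → Dec (P i)) {i} → P i → i ∈ subset P?
  ∈-subset P? {i} p = lookup⇒[]= i _ (trans (lookup∘tabulate (λ i → does (P? i)) i) (dec-true (P? i) p))

  ¬¬-∀Fin : ∀ {k p} {P : Fin k → Set p} → (∀ i → ¬ ¬ P i) → ¬ ¬ (∀ i → P i)
  ¬¬-∀Fin {zero}  _   ¬all = ¬all (λ ())
  ¬¬-∀Fin {suc k} ¬¬P ¬all =
    ¬¬P Fin.zero λ p₀ → ¬¬-∀Fin (λ i → ¬¬P (Fin.suc i)) λ rest →
      ¬all λ { Fin.zero → p₀ ; (Fin.suc i) → rest i }

  ¬¬-∀Subset : ∀ {k p} {P : Subset k → Set p} → (∀ b → ¬ ¬ P b) → ¬ ¬ (∀ b → P b)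
  ¬¬-∀Subset {zero}  ¬¬P ¬all = ¬¬P [] λ p → ¬all λ { [] → p }
  ¬¬-∀Subset {suc k} ¬¬P ¬all =
    ¬¬-∀Subset (λ b → ¬¬P (true ∷ b)) λ p-in → ¬¬-∀Subset (λ b → ¬¬P (false ∷ b)) λ p-out →
      ¬all λ { (true ∷ b) → p-in b ; (false ∷ b) → p-out b }

  ⁅⁆⊆ : ∀ {n} {u : Fin n} {p} → u ∈ p → ⁅ u ⁆ ⊆ p
  ⁅⁆⊆ {p = p} u∈p x∈⁅u⁆ = subst (_∈ p) (sym (x∈⁅y⁆⇒x≡y _ x∈⁅u⁆)) u∈p

  ⊆⇒≡⊎⊂ : ∀ {n} {p q : Subset n} → p ⊆ q → p ≡ q ⊎ p ⊂ q
  ⊆⇒≡⊎⊂ {p = p} {q} p⊆q with p ⊂? q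
  ... | yes p⊂q = inj₂ p⊂q
  ... | no p⊄q = inj₁ (⊆-antisym p⊆q q⊆p)
    where
    q⊆p : q ⊆ p
    q⊆p {x} x∈q with x ∈? p
    ... | yes x∈p = x∈p
    ... | no x∉p = contradiction ((λ {y} → p⊆q {y}) , x , x∈q , x∉p) p⊄q

  -- An increasing chain of subsets of [n'+1], starting nonempty, that can only
  -- become stationary at a full set, is full from step n' on: each non-full
  -- step adds an element.
  chain-full : ∀ {n'} (S : ℕ → Subset (suc n')) → (∀ t → S t ⊆ S (suc t)) →
               1 ≤ ∣ S 0 ∣ → (∀ t → S t ≡ S (suc t) → Full (S t)) → Full (S n')
  chain-full {n'} S S-inc nonempty stationary with grows n'
    where
    grows : ∀ t → Full (S t) ⊎ suc t ≤ ∣ S t ∣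
    grows zero = inj₂ nonempty
    grows (suc t) with grows t | ⊆⇒≡⊎⊂ (S-inc t)
    ... | inj₁ full | _ = inj₁ (λ i → S-inc t (full i))
    ... | inj₂ _ | inj₁ eq = inj₁ (λ i → S-inc t (stationary t eq i))
    ... | inj₂ big | inj₂ strict = inj₂ (≤-trans (s≤s big) (p⊂q⇒∣p∣<∣q∣ strict))
  ... | inj₁ full = full
  ... | inj₂ big = λ i → subst (i ∈_) (sym (∣p∣≡n⇒p≡⊤ (≤-antisym (∣p∣≤n (S n')) big))) ∈⊤

  module Iterates {n : ℕ} (F : Subset n → Subset n) (F-mono : ∀ {p q} → p ⊆ q → F p ⊆ F q) where

    ^-mono : ∀ r {p q} → p ⊆ q → (F ^[ r ]) p ⊆ (F ^[ r ]) q
    ^-mono zero    p⊆q = p⊆q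
    ^-mono (suc r) p⊆q = F-mono (^-mono r p⊆q)

    ^-+ : ∀ a b p → (F ^[ a + b ]) p ≡ (F ^[ a ]) ((F ^[ b ]) p)
    ^-+ a b p = cong-app (Endo.^-homo (Subset n) F a b) p

  -- Arithmetic behind the exponent (n-1)²+1: a walk of length d into a cycle of
  -- length L, with d + L ≤ n and L ≤ n-1 (or n = 1), satisfies (n-1)L + d ≤ (n-1)²+1.
  walk-length-bound : ∀ n' d ℓ → d + suc ℓ ≤ suc n' → (suc ℓ < suc n' ⊎ n' ≡ 0) →
                      n' * suc ℓ + d ≤ n' ^ 2 + 1
  walk-length-bound .0 d ℓ fits (inj₂ refl) = ≤-trans (m≤m+n d (suc ℓ)) fits
  walk-length-bound (suc q) d ℓ fits (inj₁ (s≤s ℓ<q)) with m≤n⇒∃[o]m+o≡n ℓ<q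
  ... | f , refl = begin
    suc (ℓ + f) * suc ℓ + d                        ≤⟨ ℕₚ.+-monoʳ-≤ (suc (ℓ + f) * suc ℓ) d≤ ⟩
    suc (ℓ + f) * suc ℓ + suc f                    ≤⟨ m≤m+n _ ((ℓ + f) * f) ⟩
    suc (ℓ + f) * suc ℓ + suc f + (ℓ + f) * f      ≡⟨ square ℓ f ⟩
    suc (ℓ + f) ^ 2 + 1                            ∎
    where
    open ℕₚ.≤-Reasoning
    square : ∀ ℓ f → suc (ℓ + f) * suc ℓ + suc f + (ℓ + f) * f ≡ suc (ℓ + f) * (suc (ℓ + f) * 1) + 1
    square = solve-∀
    d≤ : d ≤ suc f
    d≤ = ℕₚ.+-cancelʳ-≤ (suc ℓ) d (suc f) (≤-trans fits (≤-reflexive (rearrange ℓ f)))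
      where
      rearrange : ∀ ℓ f → suc (suc (ℓ + f)) ≡ suc f + suc ℓ
      rearrange = solve-∀

  no-room : ∀ {c k n} → c + suc k ≤ n → n ≤ suc k → c ≡ 0 × suc k ≡ n
  no-room {zero}      fits tight = refl , ≤-antisym fits tight
  no-room {suc c} {k} fits tight = contradiction (≤-trans fits tight) (ℕₚ.<⇒≱ (ℕₚ.m<n+m (suc k) (s≤s z≤n)))

  -- Read
  -- w ∈ F ⁅u⁆ as an arc u → w; by monotonicity, walks of length r from u land in
  -- (F ^[ r ]) ⁅u⁆.
  module Wielandt {n' : ℕ} (F : Subset (suc n') → Subset (suc n'))
                  (F-mono : ∀ {p q} → p ⊆ q → F p ⊆ F q) where

    open Iterates F F-mono

    n : ℕ
    n = suc n'

    _⟶[_]_ : Fin n → ℕ → Fin n → Set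
    u ⟶[ r ] w = w ∈ (F ^[ r ]) ⁅ u ⁆

    ⟶-trans : ∀ {u v w} a b → u ⟶[ a ] v → v ⟶[ b ] w → u ⟶[ b + a ] w
    ⟶-trans {u} a b u⟶v v⟶w = subst (_ ∈_) (sym (^-+ b a ⁅ u ⁆)) (^-mono b (⁅⁆⊆ u⟶v) v⟶w)

    module Primitive (g : ℕ) (full-reach : ∀ j → Full ((F ^[ suc g ]) ⁅ j ⁆)) where

      full-F : ∀ {p} → Full p → Full (F p)
      full-F {p} full i = F-mono {(F ^[ g ]) ⁅ i ⁆} (λ {x} _ → full x) (full-reach i i)

      full-^ : ∀ r {p} → Full p → Full ((F ^[ r ]) p)
      full-^ zero    full = full
      full-^ (suc r) full = full-F (full-^ r full)

      full-later : ∀ {a b} p → a ≤ b → Full ((F ^[ a ]) p) → Full ((F ^[ b ]) p)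
      full-later {a} {b} p a≤b full =
        subst (λ r → Full ((F ^[ r ]) p)) (m∸n+n≡m a≤b)
              (subst Full (sym (^-+ (b ∸ a) a p)) (full-^ (b ∸ a) full))

      -- A closed walk of length L through v fills everything after (n-1)L steps:
      -- the sets (F ^[ tL ]) ⁅v⁆ increase with t and can only stabilise at a set
      -- fixed by F ^[ L ], which then contains the full set (F ^[ (g+1)L ]) ⁅v⁆.
      closed-walk-fills : ∀ {v ℓ} → v ⟶[ suc ℓ ] v → Full ((F ^[ n' * suc ℓ ]) ⁅ v ⁆)
      closed-walk-fills {v} {ℓ} closed =
        chain-full S S-inc (≤-reflexive (sym (∣⁅x⁆∣≡1 v))) S-stationary
        where
        L : ℕ
        L = suc ℓ

        S : ℕ → Subset n
        S t = (F ^[ t * L ]) ⁅ v ⁆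

        S-step : ∀ t → S (suc t) ≡ (F ^[ L ]) (S t)
        S-step t = ^-+ L (t * L) ⁅ v ⁆

        S-inc : ∀ t → S t ⊆ S (suc t)
        S-inc zero    = subst (⁅ v ⁆ ⊆_) (sym (S-step 0)) (⁅⁆⊆ closed)
        S-inc (suc t) = subst₂ _⊆_ (sym (S-step t)) (sym (S-step (suc t))) (^-mono L (S-inc t))

        v∈S : ∀ t → v ∈ S t
        v∈S zero    = x∈⁅x⁆ v
        v∈S (suc t) = S-inc t (v∈S t)

        S-stationary : ∀ t → S t ≡ S (suc t) → Full (S t)
        S-stationary t eq = subst Full (fixed (suc g)) (λ i → ^-mono (suc g * L) (⁅⁆⊆ (v∈S t)) (filled i))
          where
          fixed : ∀ k → (F ^[ k * L ]) (S t) ≡ S t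
          fixed zero    = refl
          fixed (suc k) = trans (^-+ L (k * L) (S t))
                                (trans (cong (F ^[ L ]) (fixed k)) (trans (sym (S-step t)) (sym eq)))
          filled : Full ((F ^[ suc g * L ]) ⁅ v ⁆)
          filled = full-later ⁅ v ⁆ (m≤m*n (suc g) L) (full-reach v)

      -- Every vertex has an out-neighbour, as (F ^[ g+1 ]) ⁅u⁆ is nonempty.
      successor : ∀ u → ∃ λ w → u ⟶[ 1 ] w
      successor u with any? (λ w → w ∈? F ⁅ u ⁆)
      ... | yes found = found
      ... | no none = contradiction (full-reach u u) (dead-end g u)
        where
        dead-end : ∀ k w → w ∉ (F ^[ suc k ]) ⁅ u ⁆
        dead-end zero    w w∈ = none (w , w∈)
        dead-end (suc k) w w∈ = none (w , F-mono (λ {y} y∈ → contradiction y∈ (dead-end k y)) w∈)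

      s : Fin n → Fin n
      s u = proj₁ (successor u)

      record ShortCycle (j : Fin n) : Set where
        constructor cycle
        field
          d ℓ    : ℕ
          v      : Fin n
          enter  : j ⟶[ d ] v
          closed : v ⟶[ suc ℓ ] v
          fits   : d + suc ℓ ≤ n
          short  : suc ℓ < n ⊎ n' ≡ 0

      -- The orbit x t = s^t j of j follows arcs; a repetition on it, or an arc
      -- leaving it, produces a short cycle.
      module Orbit (j : Fin n) where

        x : ℕ → Fin n
        x zero    = j
        x (suc t) = s (x t)

        orbit-walk : ∀ ℓ t → x t ⟶[ ℓ ] x (ℓ + t)
        orbit-walk zero    t = x∈⁅x⁆ (x t)
        orbit-walk (suc ℓ) t = F-mono (⁅⁆⊆ (orbit-walk ℓ t)) (proj₂ (successor (x (ℓ + t))))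

        from-start : ∀ a → j ⟶[ a ] x a
        from-start a = subst (λ t → j ⟶[ a ] x t) (+-identityʳ a) (orbit-walk a 0)

        repetition : ∀ a b → a < b → b ≤ n → (b < n ⊎ 0 < a) → x a ≡ x b → ShortCycle j
        repetition a b a<b b≤n shorter xa≡xb with m≤n⇒∃[o]m+o≡n a<b
        ... | ℓ , refl = cycle a ℓ (x a) (from-start a) closed fits short
          where
          closed : x a ⟶[ suc ℓ ] x a
          closed = subst (x a ⟶[ suc ℓ ]_) (trans (cong (λ t → x (suc t)) (+-comm ℓ a)) (sym xa≡xb))
                         (orbit-walk (suc ℓ) a)
          fits : a + suc ℓ ≤ n
          fits = subst (_≤ n) (sym (+-suc a ℓ)) b≤n
          short : suc ℓ < n ⊎ n' ≡ 0
          short = inj₁ (shorter-than-n shorter)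
            where
            shorter-than-n : (suc (a + ℓ) < n ⊎ 0 < a) → suc ℓ < n
            shorter-than-n (inj₁ b<n) = ≤-trans (s≤s (s≤s (ℕₚ.m≤n+m ℓ a))) b<n
            shorter-than-n (inj₂ 0<a) = ≤-trans (s≤s (ℕₚ.+-monoˡ-≤ ℓ 0<a)) b≤n

        -- If y is not among the first n orbit points, the orbit points avoid y, so
        -- the pigeonhole principle applies in the remaining n - 1 vertices.
        avoid : ∀ {y} → ¬ (∃ λ (p : Fin n) → x (toℕ p) ≡ y) → ∀ p → y ≢ x (toℕ p)
        avoid absent p eq = absent (p , sym eq)

        located : ∀ y → (∃ λ p → p < n × x p ≡ y) ⊎ ShortCycle j
        located y with any? (λ (p : Fin n) → x (toℕ p) ≟ y)
        ... | yes (p , eq) = inj₁ (toℕ p , toℕ<n p , eq)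
        ... | no absent with pigeonhole (ℕₚ.n<1+n n') (λ p → punchOut (avoid absent p))
        ...   | p , q , p<q , eq = inj₂ (repetition (toℕ p) (toℕ q) p<q (ℕₚ.<⇒≤ (toℕ<n q)) (inj₁ (toℕ<n q))
                                           (punchOut-injective (avoid absent p) (avoid absent q) eq))

        -- If every arc from u went to s u, the sets (F ^[ t ]) ⁅j⁆ would stay
        -- singletons, which cannot be full once n ≥ 2.
        chord : n' ≢ 0 → ∃₂ λ u w → u ⟶[ 1 ] w × w ≢ s u
        chord n'≢0 with any? (λ u → any? (λ w → (w ∈? F ⁅ u ⁆) ×-dec ¬? (w ≟ s u)))
        ... | yes (u , w , arc , off) = u , w , arc , off
        ... | no none = contradiction (trans (single Fin.zero) (sym (single other))) (λ ())
          where
          along-orbit : ∀ u w → u ⟶[ 1 ] w → w ≡ s u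
          along-orbit u w arc with w ≟ s u
          ... | yes w≡su = w≡su
          ... | no off = contradiction (u , w , arc , off) none

          confined : ∀ t → (F ^[ t ]) ⁅ j ⁆ ⊆ ⁅ x t ⁆
          confined zero    y∈ = y∈
          confined (suc t) {y} y∈ =
            subst (_∈ ⁅ x (suc t) ⁆) (sym (along-orbit (x t) y (F-mono (confined t) y∈))) (x∈⁅x⁆ _)

          single : ∀ i → i ≡ x (suc g)
          single i = x∈⁅y⁆⇒x≡y _ (confined (suc g) (full-reach j i))

          other : Fin n
          other = Fin.suc (Fin.fromℕ< (ℕₚ.n≢0⇒n>0 n'≢0))

        -- An arc x a → x c back to an earlier orbit point closes a cycle of
        -- length a - c + 1; it has length n only if it is the arc x (n-1) → x n.
        back-chord : x n ≡ j → ∀ {a c} → x a ⟶[ 1 ] x c → x c ≢ s (x a) → a < n → c ≤ a → ShortCycle j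
        back-chord xn≡j {c = c} arc off a<n c≤a with m≤n⇒∃[o]m+o≡n c≤a
        ... | k , refl = cycle c k (x c) (from-start c) loop fits short
          where
          loop : x c ⟶[ suc k ] x c
          loop = ⟶-trans k 1 (subst (λ t → x c ⟶[ k ] x t) (+-comm k c) (orbit-walk k c)) arc

          fits : c + suc k ≤ n
          fits = subst (_≤ n) (sym (+-suc c k)) a<n

          wraps : c ≡ 0 × suc k ≡ n → x c ≡ s (x (c + k))
          wraps (c≡0 , k+1≡n) = begin
            x c              ≡⟨ cong x c≡0 ⟩
            j                ≡⟨ sym xn≡j ⟩
            x n              ≡⟨ cong x (sym k+1≡n) ⟩
            x (suc k)        ≡⟨ cong (λ t → x (suc t)) (sym (cong (_+ k) c≡0)) ⟩
            s (x (c + k))    ∎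
            where open ≡-Reasoning

          short : suc k < n ⊎ n' ≡ 0
          short with suc k <? n
          ... | yes k<n = inj₁ k<n
          ... | no k≮n = contradiction (wraps (no-room fits (≮⇒≥ k≮n))) off

        -- An arc x a → x c jumping ahead (past s (x a)) shortcuts the orbit:
        -- j ⟶ x a → x c ⟶ x n = j is a cycle through j shorter than n.
        forward-chord : x n ≡ j → ∀ {a c} → x a ⟶[ 1 ] x c → x c ≢ s (x a) → c < n → a < c → ShortCycle j
        forward-chord xn≡j {a} arc off c<n a<c with m≤n⇒∃[o]m+o≡n a<c
        ... | zero , refl = contradiction (cong x (+-identityʳ (suc a))) off
        ... | suc k , refl with m≤n⇒∃[o]m+o≡n (ℕₚ.<⇒≤ c<n)
        ...   | r , c+r≡n = cycle 0 (r + a) j (x∈⁅x⁆ j) loop (ℕₚ.<⇒≤ short) (inj₁ short)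
          where
          c : ℕ
          c = suc a + suc k

          back-to-j : x c ⟶[ r ] j
          back-to-j = subst (x c ⟶[ r ]_) (trans (cong x (trans (+-comm r c) c+r≡n)) xn≡j) (orbit-walk r c)

          loop : j ⟶[ suc (r + a) ] j
          loop = subst (λ l → j ⟶[ l ] j) (+-suc r a) (⟶-trans (suc a) r (⟶-trans a 1 (from-start a) arc) back-to-j)

          short : suc (r + a) < n
          short = subst (suc (r + a) <_) c+r≡n
                    (subst (suc (r + a) <_) (sym (rearrange a k r)) (m≤m+n (suc (suc (r + a))) k))
            where
            rearrange : ∀ a k r → suc a + suc k + r ≡ suc (suc (r + a)) + k
            rearrange = solve-∀

        -- If the orbit closes up only after n steps (x n = j), then either n = 1
        -- and j has a loop, or an arc leaving the orbit shortens the cycle.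
        returning : x n ≡ j → ShortCycle j
        returning xn≡j with n' ℕ.≟ 0
        ... | yes n'≡0 = cycle 0 0 j (x∈⁅x⁆ j) loop (s≤s z≤n) (inj₂ n'≡0)
          where
          loop : j ⟶[ 1 ] j
          loop = subst (j ⟶[ 1 ]_) (subst (λ k → x (suc k) ≡ j) n'≡0 xn≡j) (orbit-walk 1 0)
        ... | no n'≢0 with chord n'≢0
        ...   | u , w , arc , off with located u | located w
        ...     | inj₂ c | _      = c
        ...     | inj₁ _ | inj₂ c = c
        ...     | inj₁ (a , a<n , refl) | inj₁ (c , c<n , refl) with c ℕ.≤? a
        ...       | yes c≤a = back-chord xn≡j arc off a<n c≤a
        ...       | no c≰a  = forward-chord xn≡j arc off c<n (ℕₚ.≰⇒> c≰a)

        short-cycle : ShortCycle j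
        short-cycle with located (x n)
        ... | inj₂ c                   = c
        ... | inj₁ (zero , _ , j≡xn)   = returning (sym j≡xn)
        ... | inj₁ (suc q , q<n , eq)  = repetition (suc q) n q<n ≤-refl (inj₂ (s≤s z≤n)) eq

      -- From j, a short cycle through some v is entered after d steps; it fills
      -- everything after (n-1)L further steps, and (n-1)L + d ≤ (n-1)²+1.
      fills : ∀ j → Full ((F ^[ n' ^ 2 + 1 ]) ⁅ j ⁆)
      fills j with Orbit.short-cycle j
      ... | cycle d ℓ v enter closed fits short =
        full-later ⁅ j ⁆ (walk-length-bound n' d ℓ fits short)
          (subst Full (sym (^-+ (n' * suc ℓ) d ⁅ j ⁆))
                 (λ i → ^-mono (n' * suc ℓ) (⁅⁆⊆ enter) (closed-walk-fills closed i)))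

  wielandt : ∀ {n} (F : Subset n → Subset n) → (∀ {p q} → p ⊆ q → F p ⊆ F q) →
             ∀ g → (∀ j → Full ((F ^[ suc g ]) ⁅ j ⁆)) → ∀ j → Full ((F ^[ (n ∸ 1) ^ 2 + 1 ]) ⁅ j ⁆)
  wielandt {zero}   F F-mono g full-reach ()
  wielandt {suc n'} F F-mono g full-reach = Wielandt.Primitive.fills F F-mono g full-reach

-- Equality of reals is not decidable, so the
-- statement "b vanishes whenever a does" is available only up to double
-- negation; it is all the zero-pattern argument below needs.
module OrderedField {c ℓ₁ ℓ₂ : Level} (ℝ : Reals c ℓ₁ ℓ₂) where

  open import Relation.Binary.Structures using (IsTotalOrder)
  open import Relation.Nullary.Decidable using (¬¬-excluded-middle)
  open import Algebra.Bundles using (CommutativeRing)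
  import Algebra.Properties.Ring as RingProperties
  import Relation.Binary.Reasoning.Setoid as SetoidReasoning

  open Reals ℝ using (Carrier; _≈_; _≤_; _+_; _*_; -_; 0#; 1#; field-ℝ; root; root-pow)
  private module R = Reals ℝ
  open IsTotalOrder R.isTotalOrder using (total; antisym)
    renaming (trans to ≤ʳ-trans; reflexive to ≤ʳ-reflexive; refl to ≤ʳ-refl)
  open RingProperties (CommutativeRing.ring field-ℝ) using (-1*x≈-x; -‿involutive)
  open Tensors ℝ using (sumFin; prodFin; sumTuples)

  VanishesWith : Carrier → Carrier → Set ℓ₁
  VanishesWith a b = a ≈ 0# → ¬ ¬ (b ≈ 0#)

  -- 0 ≤ 1 in any ordered field: otherwise 0 ≤ -1, so 0 ≤ (-1)(-1) = 1.
  0≤1 : 0# ≤ 1#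
  0≤1 with total 0# 1#
  ... | inj₁ 0≤1 = 0≤1
  ... | inj₂ 1≤0 = ≤ʳ-trans (R.*-nonneg 0≤-1 0≤-1) (≤ʳ-reflexive (R.trans (-1*x≈-x (- 1#)) (-‿involutive 1#)))
    where
    0≤-1 : 0# ≤ (- 1#)
    0≤-1 = ≤ʳ-trans (≤ʳ-reflexive (R.sym (R.-‿inverseʳ 1#)))
             (≤ʳ-trans (R.+-mono-≤ (- 1#) 1≤0) (≤ʳ-reflexive (R.+-identityˡ (- 1#))))

  0≤0 : 0# ≤ 0#
  0≤0 = ≤ʳ-refl

  +-nonneg : ∀ {a b} → 0# ≤ a → 0# ≤ b → 0# ≤ (a + b)
  +-nonneg {a} {b} 0≤a 0≤b =
    ≤ʳ-trans 0≤b (≤ʳ-trans (≤ʳ-reflexive (R.sym (R.+-identityˡ b))) (R.+-mono-≤ b 0≤a))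

  +-vanishˡ : ∀ {a b} → 0# ≤ a → 0# ≤ b → a + b ≈ 0# → a ≈ 0#
  +-vanishˡ {a} {b} 0≤a 0≤b a+b≈0 = antisym a≤0 0≤a
    where
    a≤0 : a ≤ 0#
    a≤0 = ≤ʳ-trans (≤ʳ-reflexive (R.sym (R.+-identityˡ a)))
            (≤ʳ-trans (R.+-mono-≤ a 0≤b) (≤ʳ-reflexive (R.trans (R.+-comm b a) a+b≈0)))

  +-vanishʳ : ∀ {a b} → 0# ≤ a → 0# ≤ b → a + b ≈ 0# → b ≈ 0#
  +-vanishʳ 0≤a 0≤b a+b≈0 = +-vanishˡ 0≤b 0≤a (R.trans (R.+-comm _ _) a+b≈0)

  +-zero : ∀ {a b} → a ≈ 0# → b ≈ 0# → a + b ≈ 0#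
  +-zero a≈0 b≈0 = R.trans (R.+-cong a≈0 b≈0) (R.+-identityˡ 0#)

  *-zeroˡ : ∀ {a b} → a ≈ 0# → a * b ≈ 0#
  *-zeroˡ {b = b} a≈0 = R.trans (R.*-cong a≈0 R.refl) (R.zeroˡ b)

  *-zeroʳ : ∀ {a b} → b ≈ 0# → a * b ≈ 0#
  *-zeroʳ {a} b≈0 = R.trans (R.*-cong R.refl b≈0) (R.zeroʳ a)

  *-cancel : ∀ {a b} → ¬ (a ≈ 0#) → a * b ≈ 0# → b ≈ 0#
  *-cancel {a} {b} a≉0 ab≈0 with R.inverse a a≉0
  ... | a⁻¹ , aa⁻¹≈1 = begin
    b              ≈⟨ R.sym (R.*-identityˡ b) ⟩
    1# * b         ≈⟨ R.*-cong (R.sym aa⁻¹≈1) R.refl ⟩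
    (a * a⁻¹) * b  ≈⟨ R.*-cong (R.*-comm a a⁻¹) R.refl ⟩
    (a⁻¹ * a) * b  ≈⟨ R.*-assoc a⁻¹ a b ⟩
    a⁻¹ * (a * b)  ≈⟨ *-zeroʳ ab≈0 ⟩
    0#             ∎
    where open SetoidReasoning R.setoid

  sumFin-nonneg : ∀ k {f : Fin k → Carrier} → (∀ i → 0# ≤ f i) → 0# ≤ sumFin k f
  sumFin-nonneg zero    _  = 0≤0
  sumFin-nonneg (suc k) f≥0 = +-nonneg (f≥0 Fin.zero) (sumFin-nonneg k (λ i → f≥0 (Fin.suc i)))

  prodFin-nonneg : ∀ k {f : Fin k → Carrier} → (∀ i → 0# ≤ f i) → 0# ≤ prodFin k f
  prodFin-nonneg zero    _  = 0≤1
  prodFin-nonneg (suc k) f≥0 = R.*-nonneg (f≥0 Fin.zero) (prodFin-nonneg k (λ i → f≥0 (Fin.suc i)))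

  sumTuples-nonneg : ∀ k n {f : (Fin k → Fin n) → Carrier} → (∀ t → 0# ≤ f t) → 0# ≤ sumTuples k n f
  sumTuples-nonneg zero    n f≥0 = f≥0 _
  sumTuples-nonneg (suc k) n f≥0 = sumFin-nonneg n (λ i → sumTuples-nonneg k n (λ t → f≥0 _))

  sumFin-vanishes : ∀ k {f g : Fin k → Carrier} → (∀ i → 0# ≤ f i) →
                    (∀ i → VanishesWith (f i) (g i)) → VanishesWith (sumFin k f) (sumFin k g)
  sumFin-vanishes zero    _   _  _    = contradiction R.refl
  sumFin-vanishes (suc k) {f} f≥0 vw f≈0 g≉0 =
    vw Fin.zero (+-vanishˡ (f≥0 Fin.zero) rest≥0 f≈0) λ g₀≈0 →
      sumFin-vanishes k (λ i → f≥0 (Fin.suc i)) (λ i → vw (Fin.suc i)) (+-vanishʳ (f≥0 Fin.zero) rest≥0 f≈0)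
        λ rest≈0 → g≉0 (+-zero g₀≈0 rest≈0)
    where
    rest≥0 : 0# ≤ sumFin k (λ i → f (Fin.suc i))
    rest≥0 = sumFin-nonneg k (λ i → f≥0 (Fin.suc i))

  sumTuples-vanishes : ∀ k n {f g : (Fin k → Fin n) → Carrier} → (∀ t → 0# ≤ f t) →
                       (∀ t → VanishesWith (f t) (g t)) → VanishesWith (sumTuples k n f) (sumTuples k n g)
  sumTuples-vanishes zero    n f≥0 vw = vw _
  sumTuples-vanishes (suc k) n f≥0 vw =
    sumFin-vanishes n (λ i → sumTuples-nonneg k n (λ t → f≥0 _)) (λ i → sumTuples-vanishes k n (λ t → f≥0 _) (λ t → vw _))

  prodFin-vanishes : ∀ k {f g : Fin k → Carrier} →
                     (∀ i → VanishesWith (f i) (g i)) → VanishesWith (prodFin k f) (prodFin k g)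
  prodFin-vanishes zero    _  1≈0 = contradiction 1≈0 R.nontrivial
  prodFin-vanishes (suc k) vw f≈0 g≉0 = ¬¬-excluded-middle λ where
    (yes f₀≈0) → vw Fin.zero f₀≈0 (λ g₀≈0 → g≉0 (*-zeroˡ g₀≈0))
    (no f₀≉0)  → prodFin-vanishes k (λ i → vw (Fin.suc i)) (*-cancel f₀≉0 f≈0) (λ rest≈0 → g≉0 (*-zeroʳ rest≈0))

  *-vanishes : ∀ a {p q} → VanishesWith p q → VanishesWith (a * p) (a * q)
  *-vanishes a vw ap≈0 aq≉0 = ¬¬-excluded-middle λ where
    (yes a≈0) → aq≉0 (*-zeroˡ a≈0)
    (no a≉0)  → vw (*-cancel a≉0 ap≈0) (λ q≈0 → aq≉0 (*-zeroʳ q≈0))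

  pow-nonzero : ∀ k {r} → ¬ (r ≈ 0#) → ¬ (pow field-ℝ r k ≈ 0#)
  pow-nonzero zero    r≉0 = R.nontrivial
  pow-nonzero (suc k) r≉0 rᵏ⁺¹≈0 = pow-nonzero k r≉0 (*-cancel r≉0 rᵏ⁺¹≈0)

  root-nonzero : ∀ k {z} → 0# ≤ z → ¬ (z ≈ 0#) → ¬ (root (suc k) z ≈ 0#)
  root-nonzero k 0≤z z≉0 root≈0 = z≉0 (R.trans (R.sym (root-pow k 0≤z)) (*-zeroˡ root≈0))

  root-vanishes : ∀ k {z} → 0# ≤ z → ¬ ¬ (z ≈ 0#) → ¬ ¬ (root (suc k) z ≈ 0#)
  root-vanishes k 0≤z z≈0 root≉0 = z≈0 (λ z≈0 → pow-nonzero (suc k) root≉0 (R.trans (root-pow k 0≤z) z≈0))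

-- Zero patterns under a nonnegative tensor A of order m'+2.  A vector x has
-- pattern b ⊆ [n] when x ≥ 0 is nonzero on b and (classically) zero off b.
-- Whether A x vanishes at i depends only on the pattern of x; given an oracle
-- deciding this on indicator vectors, A and T_A both act on patterns by one
-- monotone map F, turning both conditions of the theorem into properties of F.
module ZeroPatterns {c ℓ₁ ℓ₂ : Level} (ℝ : Reals c ℓ₁ ℓ₂) {m' n : ℕ}
                    (A : Tensors.Tensor ℝ (suc (suc m')) n) (A-nonneg : Tensors.NonnegTensor ℝ A) where

  open import Data.Empty using (⊥-elim)
  open import Data.Fin.Properties using (_≟_)
  open import Relation.Nullary.Decidable using (¬?; ¬¬-excluded-middle; decidable-stable)
  import Data.Nat.Properties as ℕₚ

  open Reals ℝ using (_≈_; 0#; 1#)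
  module R = Reals ℝ
  open Tensors ℝ
  open OrderedField ℝ
  open Combinatorics using (Full; subset; subset-∈; ∈-subset; ¬¬-∀Fin; ¬¬-∀Subset; ⁅⁆⊆; _^[_]; wielandt)

  apply-nonneg : ∀ {x} → Nonneg x → Nonneg (apply A x)
  apply-nonneg x≥0 i =
    sumTuples-nonneg (suc m') n (λ t → R.*-nonneg (A-nonneg i t) (prodFin-nonneg (suc m') (λ j → x≥0 (t j))))

  T-nonneg : ∀ {x} → Nonneg x → Nonneg (T A x)
  T-nonneg x≥0 i = R.root-nonneg m' (apply-nonneg x≥0 i)

  iter-nonneg : ∀ {f : Vector n → Vector n} → (∀ {x} → Nonneg x → Nonneg (f x)) →
                ∀ r {x} → Nonneg x → Nonneg (iter f r x)
  iter-nonneg f-nonneg zero    x≥0 = x≥0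
  iter-nonneg f-nonneg (suc r) x≥0 = f-nonneg (iter-nonneg f-nonneg r x≥0)

  apply-vanishes : ∀ {x y} → Nonneg x → (∀ j → VanishesWith (x j) (y j)) →
                   ∀ i → VanishesWith (apply A x i) (apply A y i)
  apply-vanishes x≥0 vw i = sumTuples-vanishes (suc m') n
    (λ t → R.*-nonneg (A-nonneg i t) (prodFin-nonneg (suc m') (λ j → x≥0 (t j))))
    (λ t → *-vanishes (entry A i t) (prodFin-vanishes (suc m') (λ j → vw (t j))))

  record Pattern (x : Vector n) (b : Subset n) : Set (ℓ₁ ⊔ ℓ₂) where
    field
      nonneg : Nonneg x
      on     : ∀ {i} → i ∈ b → ¬ (x i ≈ 0#)
      off    : ∀ {i} → i ∉ b → ¬ ¬ (x i ≈ 0#)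
  open Pattern

  pattern-vanishes : ∀ {x y b b'} → Pattern x b → Pattern y b' → b' ⊆ b → ∀ i → VanishesWith (x i) (y i)
  pattern-vanishes {b' = b'} px py b'⊆b i xᵢ≈0 with i ∈? b'
  ... | yes i∈b' = contradiction xᵢ≈0 (on px (b'⊆b i∈b'))
  ... | no i∉b'  = off py i∉b'

  vanishing-⊆ : ∀ {y z b b'} → Pattern y b → Pattern z b' → (∀ i → VanishesWith (y i) (z i)) → b' ⊆ b
  vanishing-⊆ {b = b} py pz vw {i} i∈b' with i ∈? b
  ... | yes i∈b = i∈b
  ... | no i∉b  = ⊥-elim (off py i∉b (λ yᵢ≈0 → vw i yᵢ≈0 (on pz i∈b')))

  pattern-transport : ∀ {y z b} → Pattern y b → Nonneg z →
                      (∀ i → VanishesWith (y i) (z i)) → (∀ i → VanishesWith (z i) (y i)) → Pattern z b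
  pattern-transport py z≥0 y→z z→y = record
    { nonneg = z≥0
    ; on     = λ i∈b zᵢ≈0 → z→y _ zᵢ≈0 (on py i∈b)
    ; off    = λ i∉b zᵢ≉0 → off py i∉b (λ yᵢ≈0 → y→z _ yᵢ≈0 zᵢ≉0)
    }

  ZeroDecidable : Vector n → Set ℓ₁
  ZeroDecidable y = ∀ i → Dec (y i ≈ 0#)

  support : ∀ {y} → ZeroDecidable y → Subset n
  support y≟0 = subset (λ i → ¬? (y≟0 i))

  support-pattern : ∀ {y} → Nonneg y → (y≟0 : ZeroDecidable y) → Pattern y (support y≟0)
  support-pattern y≥0 y≟0 = record
    { nonneg = y≥0
    ; on     = subset-∈ (λ i → ¬? (y≟0 i))
    ; off    = λ i∉ yᵢ≉0 → i∉ (∈-subset (λ i → ¬? (y≟0 i)) yᵢ≉0)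
    }

  χ : Subset n → Vector n
  χ b i with i ∈? b
  ... | yes _ = 1#
  ... | no _  = 0#

  χ-pattern : ∀ b → Pattern (χ b) b
  χ-pattern b = record { nonneg = nonneg′ ; on = on′ ; off = off′ }
    where
    nonneg′ : Nonneg (χ b)
    nonneg′ i with i ∈? b
    ... | yes _ = 0≤1
    ... | no _  = 0≤0
    on′ : ∀ {i} → i ∈ b → ¬ (χ b i ≈ 0#)
    on′ {i} i∈b with i ∈? b
    ... | yes _   = R.nontrivial
    ... | no i∉b  = contradiction i∈b i∉b
    off′ : ∀ {i} → i ∉ b → ¬ ¬ (χ b i ≈ 0#)
    off′ {i} i∉b with i ∈? b
    ... | yes i∈b = contradiction i∈b i∉b
    ... | no _    = contradiction R.refl

  e-pattern : ∀ j → Pattern (e j) ⁅ j ⁆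
  e-pattern j = record { nonneg = nonneg′ ; on = on′ ; off = off′ }
    where
    nonneg′ : Nonneg (e j)
    nonneg′ i with j ≟ i
    ... | yes _ = 0≤1
    ... | no _  = 0≤0
    on′ : ∀ {i} → i ∈ ⁅ j ⁆ → ¬ (e j i ≈ 0#)
    on′ {i} i∈ with j ≟ i
    ... | yes _   = R.nontrivial
    ... | no j≢i  = contradiction (sym (x∈⁅y⁆⇒x≡y j i∈)) j≢i
    off′ : ∀ {i} → i ∉ ⁅ j ⁆ → ¬ ¬ (e j i ≈ 0#)
    off′ {i} i∉ with j ≟ i
    ... | yes refl = contradiction (x∈⁅x⁆ j) i∉
    ... | no _     = contradiction R.refl

  pattern-positive : ∀ {y b} → Pattern y b → Full b → Positive y
  pattern-positive py full i = nonneg py i , λ 0≈yᵢ → on py (full i) (R.sym 0≈yᵢ)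

  positive-full : ∀ {y b} → Pattern y b → Positive y → Full b
  positive-full {b = b} py pos i with i ∈? b
  ... | yes i∈b = i∈b
  ... | no i∉b  = ⊥-elim (off py i∉b (λ yᵢ≈0 → proj₂ (pos i) (R.sym yᵢ≈0)))

  Oracle : Set ℓ₁
  Oracle = ∀ b → ZeroDecidable (apply A (χ b))

  module WithOracle (oracle : Oracle) where

    -- F b is the pattern of A x for every x of pattern b.
    F : Subset n → Subset n
    F b = support (oracle b)

    apply-pattern : ∀ {x b} → Pattern x b → Pattern (apply A x) (F b)
    apply-pattern {x} {b} px =
      pattern-transport (support-pattern (apply-nonneg (nonneg (χ-pattern b))) (oracle b))
        (apply-nonneg (nonneg px))
        (apply-vanishes (nonneg (χ-pattern b)) (pattern-vanishes (χ-pattern b) px (λ i∈ → i∈)))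
        (apply-vanishes (nonneg px) (pattern-vanishes px (χ-pattern b) (λ i∈ → i∈)))

    F-mono : ∀ {b b'} → b ⊆ b' → F b ⊆ F b'
    F-mono {b} {b'} b⊆b' =
      vanishing-⊆ (support-pattern (apply-nonneg (nonneg (χ-pattern b'))) (oracle b'))
                  (support-pattern (apply-nonneg (nonneg (χ-pattern b))) (oracle b))
                  (apply-vanishes (nonneg (χ-pattern b')) (pattern-vanishes (χ-pattern b') (χ-pattern b) b⊆b'))

    -- Taking nonnegative roots does not change patterns.
    T-pattern : ∀ {x b} → Pattern x b → Pattern (T A x) (F b)
    T-pattern px = record
      { nonneg = T-nonneg (nonneg px)
      ; on     = λ i∈ → root-nonzero m' (apply-nonneg (nonneg px) _) (on (apply-pattern px) i∈)
      ; off    = λ i∉ → root-vanishes m' (apply-nonneg (nonneg px) _) (off (apply-pattern px) i∉)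
      }

    iter-pattern : ∀ {f : Vector n → Vector n} → (∀ {x b} → Pattern x b → Pattern (f x) (F b)) →
                   ∀ r {x b} → Pattern x b → Pattern (iter f r x) ((F ^[ r ]) b)
    iter-pattern f-pattern zero    px = px
    iter-pattern f-pattern (suc r) px = f-pattern (iter-pattern f-pattern r px)

    open Combinatorics.Iterates F F-mono using (^-mono)

    -- The combinatorial form of both conditions: F ^[ r ] fills every singleton.
    FullReach : ℕ → Set
    FullReach r = ∀ j → Full ((F ^[ r ]) ⁅ j ⁆)

    positive⇒reach : ∀ r → AllPositiveAt A r → FullReach r
    positive⇒reach r pos j = positive-full (iter-pattern apply-pattern r (e-pattern j)) (pos j)

    reach⇒positive : ∀ r → FullReach r → AllPositiveAt A r
    reach⇒positive r reach j = pattern-positive (iter-pattern apply-pattern r (e-pattern j)) (reach j)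

    primitive⇒reach : ∀ r → PrimitiveAt A r → FullReach r
    primitive⇒reach r prim j =
      positive-full (iter-pattern T-pattern r (e-pattern j))
                    (prim (e j) (nonneg (e-pattern j)) (j , on (e-pattern j) (x∈⁅x⁆ j)))

    -- If x ≠ 0 has decidable zeros, its support contains some ⁅ j ⁆.
    reach⇒T-positive : ∀ r → FullReach r → ∀ {x} → Nonneg x → Nonzero x → ZeroDecidable x →
                       Positive (iter (T A) r x)
    reach⇒T-positive r reach x≥0 (j , xⱼ≉0) x≟0 =
      pattern-positive (iter-pattern T-pattern r (support-pattern x≥0 x≟0))
        (λ i → ^-mono r (⁅⁆⊆ (∈-subset (λ i → ¬? (x≟0 i)) xⱼ≉0)) (reach j i))

  open WithOracle using (F; F-mono; primitive⇒reach; positive⇒reach; reach⇒positive; reach⇒T-positive)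

  -- Apart from nonnegativity, positivity is a negative statement, so it may be
  -- established under double negation.
  stable-positive : ∀ {y : Vector n} → Nonneg y → ¬ ¬ Positive y → Positive y
  stable-positive y≥0 ¬¬pos i = y≥0 i , λ 0≈yᵢ → ¬¬pos (λ pos → proj₂ (pos i) 0≈yᵢ)

  -- An oracle exists classically: it is finitely many instances of excluded middle.
  ¬¬-oracle : ¬ ¬ Oracle
  ¬¬-oracle = ¬¬-∀Subset (λ b → ¬¬-∀Fin (λ i → ¬¬-excluded-middle))

  primitive⇒positive : ∀ r → PrimitiveAt A r → AllPositiveAt A r
  primitive⇒positive r prim j =
    stable-positive (iter-nonneg apply-nonneg r (nonneg (e-pattern j))) λ ¬pos →
      ¬¬-oracle λ oracle → ¬pos (reach⇒positive oracle r (primitive⇒reach oracle r prim) j)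

  positive⇒primitive : ∀ r → AllPositiveAt A r → PrimitiveAt A r
  positive⇒primitive r pos x x≥0 x≢0 =
    stable-positive (iter-nonneg T-nonneg r x≥0) λ ¬pos →
      ¬¬-oracle λ oracle → ¬¬-∀Fin (λ i → ¬¬-excluded-middle) λ x≟0 →
        ¬pos (reach⇒T-positive oracle r (positive⇒reach oracle r pos) x≥0 x≢0 x≟0)

  -- Wielandt's bound for the pattern map gives γ(A) ≤ (n-1)²+1; the
  -- inequality is decidable, so the oracle may be used to prove it.
  degree-bound : ∀ γ → IsPrimitiveDegree A γ → γ ℕ.≤ (n ℕ.∸ 1) ℕ.^ 2 ℕ.+ 1
  degree-bound zero    ((() , _) , _)
  degree-bound (suc g) ((_ , prim) , least) =
    decidable-stable (suc g ℕ.≤? K) λ γ≰K → ¬¬-oracle λ oracle →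
      γ≰K (least K (ℕₚ.m≤n+m 1 _) (positive⇒primitive K (positive-within-K oracle)))
    where
    K : ℕ
    K = (n ℕ.∸ 1) ℕ.^ 2 ℕ.+ 1

    positive-within-K : Oracle → AllPositiveAt A K
    positive-within-K oracle =
      reach⇒positive oracle K (wielandt (F oracle) (F-mono oracle) g (primitive⇒reach oracle (suc g) prim))

open import Data.Nat using (ℕ; _≤_; _∸_; _+_; _^_; s≤s)
open import Function using (_⇔_; mk⇔)

theorem3p4 : ∀ {c ℓ₁ ℓ₂ : Level} (ℝ : Reals c ℓ₁ ℓ₂) (m n : ℕ) → 2 ≤ m →
    (A : Tensors.Tensor ℝ m n) → Tensors.NonnegTensor ℝ A →
    (Tensors.Primitive ℝ A ⇔ (∃ λ k → 1 ≤ k × Tensors.AllPositiveAt ℝ A k))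
    × (∀ k → Tensors.IsLeastPos ℝ (Tensors.AllPositiveAt ℝ A) k → Tensors.IsPrimitiveDegree ℝ A k)
    × (∀ γ → Tensors.IsPrimitiveDegree ℝ A γ → γ ≤ (n ∸ 1) ^ 2 + 1)
theorem3p4 ℝ zero           n ()       A A-nonneg
theorem3p4 ℝ (suc zero)     n (s≤s ()) A A-nonneg
theorem3p4 ℝ (suc (suc m')) n _        A A-nonneg =
    mk⇔ (λ (r , r≥1 , prim) → r , r≥1 , primitive⇒positive r prim)
        (λ (k , k≥1 , pos) → k , k≥1 , positive⇒primitive k pos)
  , (λ k ((k≥1 , pos) , least) →
       (k≥1 , positive⇒primitive k pos) , λ s s≥1 prim → least s s≥1 (primitive⇒positive s prim))
  , degree-bound
  where open ZeroPatterns ℝ A A-nonneg
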